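{- Let $e$ be a one-free expression and $f\in\mathcal E(X)$. Then $e\lesssim f$ if and only if for every alphabet $\Sigma$ and every $\sigma:X\to\mathcal P(\Sigma^\star)$ with $\epsilon\notin\bigcup_{x\in X}\sigma(x)$, we have $[\![e]\!]_\sigma\subseteq[\![f]\!]_\sigma$.
   Context: Fix a set $X$ of variables. Expressions $\mathcal E(X)$ are generated by $e,f::= x \mid 0\mid 1\mid e+f\mid e\cdot f\mid e\cap f\mid e^+\mid \overline{e}$ ($x\in X$); one-free expressions are those not containing $1$. Semantics: for an alphabet $\Sigma$ and $\sigma:X\to\mathcal P(\Sigma^\star)$, $[\![x]\!]_\sigma=\sigma(x)$, $[\![0]\!]_\sigma=\emptyset$, $[\![1]\!]_\sigma=\{\epsilon\}$, $+$ union, $\cap$ intersection, $\cdot$ concatenation, $e^+$ is $\bigcup_{n\ge1}[\![e]\!]_\sigma^n$, $\overline e$ the set of reversed words. $e\lesssim f$ means $[\![e]\!]_\sigma\subseteq[\![f]\!]_\sigma$ for every alphabet $\Sigma$ and every $\sigma:X\to\mathcal P(\Sigma^\star)$. -}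

module Defs where

open import Data.List using (List; []; _∷_; _++_; reverse)
open import Data.Product using (Σ; _×_; ∃; ∃-syntax; _,_)
open import Data.Sum using (_⊎_)
open import Data.Empty using (⊥)
open import Data.Unit using (⊤)
open import Data.Bool using (Bool; true; false)
open import Relation.Binary.PropositionalEquality using (_≡_)
open import Relation.Nullary using (¬_)

data Expr (X : Set) : Set where
  var  : X → Expr X
  𝟘    : Expr X
  𝟙    : Expr X
  _⊕_  : Expr X → Expr X → Expr X
  _⊙_  : Expr X → Expr X → Expr X
  _⊓_  : Expr X → Expr X → Expr X
  _⁺   : Expr X → Expr X
  conv : Expr X → Expr X

OneFree : {X : Set} → Expr X → Set
OneFree (var x) = ⊤
OneFree 𝟘 = ⊤
OneFree 𝟙 = ⊥
OneFree (e ⊕ f) = OneFree e × OneFree f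
OneFree (e ⊙ f) = OneFree e × OneFree f
OneFree (e ⊓ f) = OneFree e × OneFree f
OneFree (e ⁺) = OneFree e
OneFree (conv e) = OneFree e

Lang : Set → Set₁
Lang A = List A → Set

Concat : {A : Set} → Lang A → Lang A → Lang A
Concat L M w = ∃[ u ] ∃[ v ] (w ≡ u ++ v × L u × M v)

-- L^+ = ⋃_{n ≥ 1} L^n, as the least language with L ⊆ L⁺ and L·L⁺ ⊆ L⁺
data Plus {A : Set} (L : Lang A) : Lang A where
  one  : ∀ {w} → L w → Plus L w
  more : ∀ {u v} → L u → Plus L v → Plus L (u ++ v)

⟦_⟧ : {X A : Set} → Expr X → (X → Lang A) → Lang A
⟦ var x ⟧ σ w = σ x w
⟦ 𝟘 ⟧ σ w = ⊥
⟦ 𝟙 ⟧ σ w = w ≡ []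
⟦ e ⊕ f ⟧ σ w = ⟦ e ⟧ σ w ⊎ ⟦ f ⟧ σ w
⟦ e ⊙ f ⟧ σ w = Concat (⟦ e ⟧ σ) (⟦ f ⟧ σ) w
⟦ e ⊓ f ⟧ σ w = ⟦ e ⟧ σ w × ⟦ f ⟧ σ w
⟦ e ⁺ ⟧ σ w = Plus (⟦ e ⟧ σ) w
⟦ conv e ⟧ σ w = ⟦ e ⟧ σ (reverse w)

_⊆L_ : {A : Set} → Lang A → Lang A → Set
L ⊆L M = ∀ w → L w → M w

_≲_ : {X : Set} → Expr X → Expr X → Set₁
e ≲ f = ∀ (A : Set) (σ : _ → Lang A) → ⟦ e ⟧ σ ⊆L ⟦ f ⟧ σ

EpsFree : {X A : Set} → (X → Lang A) → Set
EpsFree σ = ∀ x → ¬ σ x []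

-- Interpret the variables over the alphabet Maybe A, with nothing as a padding letter:
-- padded σ x holds of the nonempty words whose erasure catMaybes lies in σ x, so it is
-- ε-free, and erasure maps ⟦ f ⟧ (padded σ) into ⟦ f ⟧ σ for every f.  Conversely, if
-- e is one-free and w ∈ ⟦ e ⟧ σ, then w with long enough runs of padding before, between
-- and after its letters lies in ⟦ e ⟧ (padded σ): a run of length a + b can be cut into
-- runs of lengths a and b, so every factor matched by a variable receives some padding
-- and becomes nonempty.  Thus a counterexample σ to e ≲ f yields the ε-free one padded σ.
module Submission where

open import Defs
open import Function.Bundles using (_⇔_; mk⇔)
open import Data.List using (List; []; _∷_; _++_; [_]; reverse; replicate; length; catMaybes)
open import Data.List.Properties
  using (++-assoc; ++-identityʳ; reverse-++; unfold-reverse; length-reverse;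
         length-++-≤ˡ; length-++-≤ʳ; ∷-injectiveˡ; ∷-injectiveʳ; catMaybes-++)
open import Data.Maybe using (Maybe; just; nothing)
open import Data.Nat using (ℕ; zero; suc; _+_; _*_; _≤_; s≤s)
open import Data.Nat.Properties
  using (≤-refl; ≤-trans; +-comm; +-assoc; m≤m+n; m+n≤o⇒m≤o; m+n≤o⇒n≤o;
         m≤n⇒∃[o]m+o≡n; m≤n⇒m≤1+n; +-monoʳ-≤; *-monoˡ-≤)
open import Data.Product using (∃-syntax; _×_; _,_)
open import Data.Sum using (_⊎_; inj₁; inj₂)
open import Data.Empty using (⊥-elim)
open import Relation.Binary.PropositionalEquality
  using (_≡_; _≢_; refl; sym; trans; cong; cong₂; subst; subst₂; module ≡-Reasoning)

replicate-+ : ∀ {A : Set} m n (x : A) → replicate (m + n) x ≡ replicate m x ++ replicate n x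
replicate-+ zero    n x = refl
replicate-+ (suc m) n x = cong (x ∷_) (replicate-+ m n x)

reverse-replicate : ∀ {A : Set} n (x : A) → reverse (replicate n x) ≡ replicate n x
reverse-replicate zero    x = refl
reverse-replicate (suc n) x = begin
  reverse (x ∷ replicate n x)       ≡⟨ unfold-reverse x (replicate n x) ⟩
  reverse (replicate n x) ++ [ x ]  ≡⟨ cong (_++ [ x ]) (reverse-replicate n x) ⟩
  replicate n x ++ replicate 1 x    ≡⟨ replicate-+ n 1 x ⟨
  replicate (n + 1) x               ≡⟨ cong (λ m → replicate m x) (+-comm n 1) ⟩
  replicate (suc n) x               ∎
  where open ≡-Reasoning

reverse-++-∷ : ∀ {A : Set} (xs ys : List A) x → reverse (xs ++ x ∷ ys) ≡ reverse ys ++ x ∷ reverse xs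
reverse-++-∷ xs ys x = begin
  reverse (xs ++ x ∷ ys)                ≡⟨ reverse-++ xs (x ∷ ys) ⟩
  reverse (x ∷ ys) ++ reverse xs        ≡⟨ cong (_++ reverse xs) (unfold-reverse x ys) ⟩
  (reverse ys ++ [ x ]) ++ reverse xs   ≡⟨ ++-assoc (reverse ys) [ x ] (reverse xs) ⟩
  reverse ys ++ x ∷ reverse xs          ∎
  where open ≡-Reasoning

++-∷-≡-++ : ∀ {A : Set} (xs : List A) x ys vs ws → xs ++ x ∷ ys ≡ vs ++ ws →
  (∃[ m ] (vs ≡ xs ++ x ∷ m × ys ≡ m ++ ws)) ⊎ (∃[ m ] (xs ≡ vs ++ m × ws ≡ m ++ x ∷ ys))
++-∷-≡-++ xs       x ys []       ws eq = inj₂ (xs , refl , sym eq)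
++-∷-≡-++ []       x ys (v ∷ vs) ws eq =
  inj₁ (vs , cong (_∷ vs) (sym (∷-injectiveˡ eq)) , ∷-injectiveʳ eq)
++-∷-≡-++ (y ∷ xs) x ys (v ∷ vs) ws eq with ++-∷-≡-++ xs x ys vs ws (∷-injectiveʳ eq)
... | inj₁ (m , vs≡ , ys≡) = inj₁ (m , cong₂ _∷_ (sym (∷-injectiveˡ eq)) vs≡ , ys≡)
... | inj₂ (m , xs≡ , ws≡) = inj₂ (m , cong₂ _∷_ (∷-injectiveˡ eq) xs≡ , ws≡)

catMaybes-replicate-nothing : ∀ {A : Set} n → catMaybes {A = A} (replicate n nothing) ≡ []
catMaybes-replicate-nothing zero    = refl
catMaybes-replicate-nothing (suc n) = catMaybes-replicate-nothing n

catMaybes-reverse : ∀ {A : Set} (xs : List (Maybe A)) → catMaybes (reverse xs) ≡ reverse (catMaybes xs)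
catMaybes-reverse []       = refl
catMaybes-reverse (x ∷ xs) = begin
  catMaybes (reverse (x ∷ xs))                 ≡⟨ cong catMaybes (unfold-reverse x xs) ⟩
  catMaybes (reverse xs ++ [ x ])              ≡⟨ catMaybes-++ (reverse xs) [ x ] ⟩
  catMaybes (reverse xs) ++ catMaybes [ x ]    ≡⟨ cong (_++ catMaybes [ x ]) (catMaybes-reverse xs) ⟩
  reverse (catMaybes xs) ++ catMaybes [ x ]    ≡⟨ snoc x ⟩
  reverse (catMaybes (x ∷ xs))                 ∎
  where
    open ≡-Reasoning
    snoc : ∀ x → reverse (catMaybes xs) ++ catMaybes [ x ] ≡ reverse (catMaybes (x ∷ xs))
    snoc nothing  = ++-identityʳ _
    snoc (just a) = sym (unfold-reverse a (catMaybes xs))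

module _ {A : Set} where

  -- Padded k u w: u is w with a run of at least k padding letters nothing
  -- before, between and after its letters.
  data Padded (k : ℕ) : List (Maybe A) → List A → Set where
    gap  : ∀ {g} → k ≤ g → Padded k (replicate g nothing) []
    join : ∀ {u₁ u₂ w₁ w₂ a} → Padded k u₁ w₁ → Padded k u₂ w₂ →
           Padded k (u₁ ++ just a ∷ u₂) (w₁ ++ a ∷ w₂)

  Padded-exists : ∀ k w → ∃[ u ] Padded k u w
  Padded-exists k []      = replicate k nothing , gap ≤-refl
  Padded-exists k (a ∷ w) =
    let u , p = Padded-exists k w in replicate k nothing ++ just a ∷ u , join (gap ≤-refl) p

  Padded-weaken : ∀ {j k u w} → j ≤ k → Padded k u w → Padded j u w
  Padded-weaken j≤k (gap k≤g)  = gap (≤-trans j≤k k≤g)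
  Padded-weaken j≤k (join p q) = join (Padded-weaken j≤k p) (Padded-weaken j≤k q)

  catMaybes-Padded : ∀ {k u w} → Padded k u w → catMaybes u ≡ w
  catMaybes-Padded (gap {g} _) = catMaybes-replicate-nothing g
  catMaybes-Padded (join {u₁} {u₂} {a = a} p q) =
    trans (catMaybes-++ u₁ (just a ∷ u₂)) (cong₂ (λ w₁ w₂ → w₁ ++ a ∷ w₂) (catMaybes-Padded p) (catMaybes-Padded q))

  Padded-nonempty : ∀ {k u w} → Padded (suc k) u w → u ≢ []
  Padded-nonempty (gap (s≤s _)) ()
  Padded-nonempty (join {[]}    _ _) ()
  Padded-nonempty (join {_ ∷ _} _ _) ()

  Padded-reverse : ∀ {k u w} → Padded k u w → Padded k (reverse u) (reverse w)
  Padded-reverse (gap {g} k≤g) = subst (λ u → Padded _ u []) (sym (reverse-replicate g nothing)) (gap k≤g)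
  Padded-reverse (join {u₁} {u₂} {w₁} {w₂} {a} p q) =
    subst₂ (Padded _) (sym (reverse-++-∷ u₁ u₂ (just a))) (sym (reverse-++-∷ w₁ w₂ a))
      (join (Padded-reverse q) (Padded-reverse p))

  Padded-split : ∀ {k u w} a b (w₁ w₂ : List A) → a + b ≤ k → Padded k u w → w ≡ w₁ ++ w₂ →
    ∃[ u₁ ] ∃[ u₂ ] (u ≡ u₁ ++ u₂ × Padded a u₁ w₁ × Padded b u₂ w₂)
  Padded-split a b [] [] a+b≤k (gap {g} k≤g) refl =
    let c , a+b+c≡g = m≤n⇒∃[o]m+o≡n (≤-trans a+b≤k k≤g) in
    replicate a nothing , replicate (b + c) nothing ,
    trans (cong (λ n → replicate n nothing) (trans (sym a+b+c≡g) (+-assoc a b c))) (replicate-+ a (b + c) nothing) ,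
    gap ≤-refl , gap (m≤m+n b c)
  Padded-split a b (_ ∷ _) _ _ (gap _) ()
  Padded-split a b [] (_ ∷ _) _ (gap _) ()
  Padded-split a b w₁ w₂ a+b≤k (join {u₁} {u₂} {v₁} {v₂} {c} p q) eq with ++-∷-≡-++ v₁ c v₂ w₁ w₂ eq
  ... | inj₁ (m , refl , v₂≡) with Padded-split a b m w₂ a+b≤k q v₂≡
  ...   | p₁ , p₂ , refl , pa , pb =
    u₁ ++ just c ∷ p₁ , p₂ , sym (++-assoc u₁ (just c ∷ p₁) p₂) ,
    join (Padded-weaken (m+n≤o⇒m≤o a a+b≤k) p) pa , pb
  Padded-split a b w₁ w₂ a+b≤k (join {u₁} {u₂} {v₁} {v₂} {c} p q) eq | inj₂ (m , v₁≡ , refl)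
    with Padded-split a b w₁ m a+b≤k p v₁≡
  ... | q₁ , q₂ , refl , pa , pb =
    q₁ , q₂ ++ just c ∷ u₂ , ++-assoc q₁ q₂ (just c ∷ u₂) ,
    pa , join pb (Padded-weaken (m+n≤o⇒n≤o a a+b≤k) q)

Plus-map : ∀ {A B : Set} {L : Lang A} {M : Lang B} (h : List A → List B) →
  (∀ u v → h (u ++ v) ≡ h u ++ h v) → (∀ u → L u → M (h u)) → ∀ {u} → Plus L u → Plus M (h u)
Plus-map h h-++ L⇒M (one x)              = one (L⇒M _ x)
Plus-map h h-++ L⇒M (more {u} {v} x xs) =
  subst (Plus _) (sym (h-++ u v)) (more (L⇒M u x) (Plus-map h h-++ L⇒M xs))

Plus-dropEmpty : ∀ {A : Set} {L : Lang A} {w} → Plus L w → L w ⊎ Plus (λ v → L v × v ≢ []) w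
Plus-dropEmpty (one x) = inj₁ x
Plus-dropEmpty (more {[]} _ xs) = Plus-dropEmpty xs
Plus-dropEmpty {L = L} (more {a ∷ u} {[]} x xs) with Plus-dropEmpty xs
... | inj₁ _  = inj₁ (subst L (sym (++-identityʳ (a ∷ u))) x)
... | inj₂ ys = inj₂ (more (x , λ ()) ys)
Plus-dropEmpty (more {_ ∷ _} {_ ∷ _} x xs) with Plus-dropEmpty xs
... | inj₁ y  = inj₂ (more (x , λ ()) (one (y , λ ())))
... | inj₂ ys = inj₂ (more (x , λ ()) ys)

Plus-Padded : ∀ {A : Set} {L : Lang A} {M : Lang (Maybe A)} n b →
  (∀ {k u w} → length w ≤ n → b ≤ k → Padded k u w → L w → M u) →
  ∀ {k u w} → length w ≤ n → length w * b ≤ k → Padded k u w → Plus (λ v → L v × v ≢ []) w → Plus M u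
Plus-Padded n b L⇒M _ _ _ (more {[]} (_ , u≢[]) _) = ⊥-elim (u≢[] refl)
Plus-Padded n b L⇒M {k} w≤n wb≤k p (more {a ∷ u} {v} (x , _) xs)
  with Padded-split b (length v * b) (a ∷ u) v b+vb≤k p refl
  where
    b+vb≤k : b + length v * b ≤ k
    b+vb≤k = ≤-trans (+-monoʳ-≤ b (*-monoˡ-≤ b (length-++-≤ʳ v {u}))) wb≤k
... | u₁ , u₂ , refl , p₁ , p₂ =
  more (L⇒M (≤-trans (length-++-≤ˡ (a ∷ u)) w≤n) ≤-refl p₁ x)
       (Plus-Padded n b L⇒M (≤-trans (length-++-≤ʳ v {a ∷ u}) w≤n) ≤-refl p₂ xs)
Plus-Padded n b L⇒M _ _ _ (one {[]} (_ , w≢[])) = ⊥-elim (w≢[] refl)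
Plus-Padded n b L⇒M w≤n wb≤k p (one {_ ∷ _} (x , _)) = one (L⇒M w≤n (m+n≤o⇒m≤o b wb≤k) p x)

-- A padding length that lets every word of length at most n in ⟦ e ⟧ σ be matched
-- on its padded versions; below _⁺ the word splits into at most n nonempty factors.
width : {X : Set} → ℕ → Expr X → ℕ
width n (var x)  = 1
width n 𝟘        = 0
width n 𝟙        = 0
width n (e ⊕ f)  = width n e + width n f
width n (e ⊙ f)  = width n e + width n f
width n (e ⊓ f)  = width n e + width n f
width n (e ⁺)    = suc n * width n e
width n (conv e) = width n e

module _ {X A : Set} (σ : X → Lang A) where

  padded : X → Lang (Maybe A)
  padded x u = σ x (catMaybes u) × u ≢ []

  padded-epsFree : EpsFree padded
  padded-epsFree x (_ , []≢[]) = []≢[] refl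

  ⟦⟧-padded⇒⟦⟧-catMaybes : ∀ f u → ⟦ f ⟧ padded u → ⟦ f ⟧ σ (catMaybes u)
  ⟦⟧-padded⇒⟦⟧-catMaybes (var x)  u (s , _)      = s
  ⟦⟧-padded⇒⟦⟧-catMaybes 𝟙        u refl         = refl
  ⟦⟧-padded⇒⟦⟧-catMaybes (f ⊕ g)  u (inj₁ s)     = inj₁ (⟦⟧-padded⇒⟦⟧-catMaybes f u s)
  ⟦⟧-padded⇒⟦⟧-catMaybes (f ⊕ g)  u (inj₂ t)     = inj₂ (⟦⟧-padded⇒⟦⟧-catMaybes g u t)
  ⟦⟧-padded⇒⟦⟧-catMaybes (f ⊙ g)  _ (u₁ , u₂ , refl , s , t) =
    catMaybes u₁ , catMaybes u₂ , catMaybes-++ u₁ u₂ ,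
    ⟦⟧-padded⇒⟦⟧-catMaybes f u₁ s , ⟦⟧-padded⇒⟦⟧-catMaybes g u₂ t
  ⟦⟧-padded⇒⟦⟧-catMaybes (f ⊓ g)  u (s , t)      = ⟦⟧-padded⇒⟦⟧-catMaybes f u s , ⟦⟧-padded⇒⟦⟧-catMaybes g u t
  ⟦⟧-padded⇒⟦⟧-catMaybes (f ⁺)    u s            = Plus-map catMaybes catMaybes-++ (⟦⟧-padded⇒⟦⟧-catMaybes f) s
  ⟦⟧-padded⇒⟦⟧-catMaybes (conv f) u s            =
    subst (⟦ f ⟧ σ) (catMaybes-reverse u) (⟦⟧-padded⇒⟦⟧-catMaybes f (reverse u) s)

  Padded-⟦⟧⇒⟦⟧-padded : ∀ n e → OneFree e → ∀ {k u w} → length w ≤ n → width n e ≤ k →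
    Padded k u w → ⟦ e ⟧ σ w → ⟦ e ⟧ padded u
  Padded-⟦⟧⇒⟦⟧-padded n (var x) _ _ 1≤k p s =
    subst (σ x) (sym (catMaybes-Padded p)) s , Padded-nonempty (Padded-weaken 1≤k p)
  Padded-⟦⟧⇒⟦⟧-padded n (e ⊕ f) (1∉e , 1∉f) w≤n ef≤k p (inj₁ s) =
    inj₁ (Padded-⟦⟧⇒⟦⟧-padded n e 1∉e w≤n (m+n≤o⇒m≤o _ ef≤k) p s)
  Padded-⟦⟧⇒⟦⟧-padded n (e ⊕ f) (1∉e , 1∉f) w≤n ef≤k p (inj₂ t) =
    inj₂ (Padded-⟦⟧⇒⟦⟧-padded n f 1∉f w≤n (m+n≤o⇒n≤o _ ef≤k) p t)
  Padded-⟦⟧⇒⟦⟧-padded n (e ⊓ f) (1∉e , 1∉f) w≤n ef≤k p (s , t) =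
    Padded-⟦⟧⇒⟦⟧-padded n e 1∉e w≤n (m+n≤o⇒m≤o _ ef≤k) p s ,
    Padded-⟦⟧⇒⟦⟧-padded n f 1∉f w≤n (m+n≤o⇒n≤o _ ef≤k) p t
  Padded-⟦⟧⇒⟦⟧-padded n (e ⊙ f) (1∉e , 1∉f) w≤n ef≤k p (w₁ , w₂ , refl , s , t)
    with Padded-split (width n e) (width n f) w₁ w₂ ef≤k p refl
  ... | u₁ , u₂ , u≡ , p₁ , p₂ =
    u₁ , u₂ , u≡ ,
    Padded-⟦⟧⇒⟦⟧-padded n e 1∉e (≤-trans (length-++-≤ˡ w₁) w≤n) ≤-refl p₁ s ,
    Padded-⟦⟧⇒⟦⟧-padded n f 1∉f (≤-trans (length-++-≤ʳ w₂ {w₁}) w≤n) ≤-refl p₂ t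
  Padded-⟦⟧⇒⟦⟧-padded n (e ⁺) 1∉e w≤n e⁺≤k p s with Plus-dropEmpty s
  ... | inj₁ x  = one (Padded-⟦⟧⇒⟦⟧-padded n e 1∉e w≤n (m+n≤o⇒m≤o _ e⁺≤k) p x)
  ... | inj₂ xs = Plus-Padded n (width n e) (Padded-⟦⟧⇒⟦⟧-padded n e 1∉e) w≤n
                    (≤-trans (*-monoˡ-≤ (width n e) (m≤n⇒m≤1+n w≤n)) e⁺≤k) p xs
  Padded-⟦⟧⇒⟦⟧-padded n (conv e) 1∉e {w = w} w≤n e≤k p s =
    Padded-⟦⟧⇒⟦⟧-padded n e 1∉e (subst (_≤ n) (sym (length-reverse w)) w≤n) e≤k (Padded-reverse p) s

corollary5 : {X : Set} (e f : Expr X) → OneFree e →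
    (e ≲ f) ⇔ (∀ (A : Set) (σ : X → Lang A) → EpsFree σ → ⟦ e ⟧ σ ⊆L ⟦ f ⟧ σ)
corollary5 e f 1∉e = mk⇔ (λ e≲f A σ _ → e≲f A σ) epsFree⇒≲
  where
    epsFree⇒≲ : (∀ A σ → EpsFree σ → ⟦ e ⟧ σ ⊆L ⟦ f ⟧ σ) → e ≲ f
    epsFree⇒≲ e⊆f A σ w s =
      let n = length w
          u , p = Padded-exists (width n e) w
          u∈e = Padded-⟦⟧⇒⟦⟧-padded σ n e 1∉e ≤-refl ≤-refl p s
          u∈f = e⊆f (Maybe A) (padded σ) (padded-epsFree σ) u u∈e
      in subst (⟦ f ⟧ σ) (catMaybes-Padded p) (⟦⟧-padded⇒⟦⟧-catMaybes σ f u u∈f)
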